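{- Let $n$ be a positive integer and $k\ge 1$ an integer. If $n^k\in\mathfrak{P}$, then $n\in\mathfrak{P}$.
   Context: For an odd positive integer $n$, put $G(n)=\sum_{j=1}^{n-1} j^{(n-1)/2}$. Let $\mathfrak{P}$ denote the set of odd positive integers $n$ such that $G(n)\equiv 0\pmod n$. -}

module Defs where

open import Data.Nat using (ℕ; zero; suc; _+_; _*_; _∸_; _^_; _/_)
open import Data.Nat.Divisibility using (_∣_)
open import Relation.Binary.PropositionalEquality using (_≡_)
open import Data.Nat using (_%_)
open import Data.Product using (_×_)

sumFrom1 : ℕ → (ℕ → ℕ) → ℕ
sumFrom1 zero    f = 0
sumFrom1 (suc m) f = sumFrom1 m f + f (suc m)

-- G(n) = Σ_{j=1}^{n-1} j^{(n-1)/2}   (used for odd n, so (n-1)/2 is exact)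
G : ℕ → ℕ
G n = sumFrom1 (n ∸ 1) (λ j → j ^ ((n ∸ 1) / 2))

-- n ∈ 𝔓  iff  n is an odd positive integer and G(n) ≡ 0 (mod n)
-- n odd: n % 2 ≡ 1 (odd naturals are automatically positive)
Odd : ℕ → Set
Odd n = n % 2 ≡ 1

InP : ℕ → Set
InP n = Odd n × (n ∣ G n)

module Submission where

-- Write S e n = Σ_{j<n} j^e.  For odd N = 2M+1 with M ≥ 1 we have G(N) = S M N,
-- and with n = 2m+1, N = n^k one has m ∣ M since n - 1 ∣ n^k - 1.  The proof
-- rests on three congruences for power sums, all consequences of the
-- binomial theorem applied to blocks of consecutive integers:
--   (blocks)  S e (b·a) ≡ b · S e a            (mod a),
--   (lift)    S M (b·a) ≡ b · S M a            (mod b·a)  for odd b ∣ a, M ≥ 1,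
--   (prime)   for a prime p and m ∣ M:  p ∣ S M p  ⇒  p ∣ S m p,
-- the last because either some unit g has g^m ≢ 1 (mod p), and then
-- multiplication by g permutes the residues and forces p ∣ S m p, or all units
-- satisfy g^m ≡ 1, whence S M p ≡ p - 1 (mod p).  Repeated lifting reduces
-- n^k ∣ S M (n^k) to n ∣ S M n; a strong induction over n, peeling off a
-- prime factor p of n = p·r and using (lift) when p ∣ r and (blocks) with
-- coprimality otherwise, transfers n ∣ S M n to n ∣ S m n = G(n).

open import Defs
open import Data.Nat
  using (ℕ; zero; suc; _+_; _*_; _∸_; _^_; _%_; _/_; _<_; _≤_; _≥_; s≤s; z≤n; z<s; NonZero; >-nonZero; nonTrivial⇒n>1)
open import Data.Nat.Properties
open import Data.Nat.DivMod
  using (m≡m%n+[m/n]*n; m%n<n; m<n⇒m%n≡m; %-remove-+ʳ; m*n/n≡m; [m+kn]%n≡m%n)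
open import Data.Nat.Divisibility
open import Data.Nat.Coprimality using (Coprime; coprime-divisor)
import Data.Nat.Coprimality as Coprime
open import Data.Nat.Primality using (Prime; euclidsLemma; prime⇒irreducible; prime⇒nonZero; prime⇒nonTrivial)
open import Data.Nat.Primality.Factorisation using (factorise)
open import Data.Nat.Induction using (<-rec)
open import Data.List using (_∷_)
open import Data.Nat.ListAction using (product)
open import Data.List.Relation.Unary.All using (_∷_)
open import Data.Fin using (Fin; toℕ; fromℕ<; punchOut)
open import Data.Fin.Properties using (toℕ-injective; toℕ-fromℕ<; toℕ<n; any?; injective⇒≤; punchOut-injective)
open import Data.Fin.Permutation using (Permutation)
open import Function using (id; _∘_)
open import Function.Bundles using (mk↔ₛ′)
open import Function.Definitions using (Injective)
import Algebra.Properties.CommutativeMonoid.Sum as CommutativeMonoidSum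
open import Data.Product using (∃; _,_; proj₁; proj₂; _×_)
open import Data.Sum using (inj₁; inj₂)
open import Data.Empty using (⊥-elim)
open import Relation.Nullary using (¬_; yes; no; ¬?)
open import Relation.Nullary.Decidable using (decidable-stable)
open import Relation.Binary.PropositionalEquality
open import Data.Nat.Tactic.RingSolver using (solve-∀)
open ≡-Reasoning

infix 4 _≡_[mod_]
record _≡_[mod_] (x y d : ℕ) : Set where
  constructor congruence
  field
    mod-quotient : ℕ
    mod-equation : x ≡ y + d * mod-quotient
open _≡_[mod_]

mod-∣⇒ : ∀ {x y d} → x ≡ y [mod d ] → d ∣ x → d ∣ y
mod-∣⇒ {d = d} (congruence K refl) d∣x = ∣m+n∣m⇒∣n (subst (d ∣_) (+-comm _ (d * K)) d∣x) (m∣m*n K)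

mod-∣⇐ : ∀ {x y d} → x ≡ y [mod d ] → d ∣ y → d ∣ x
mod-∣⇐ (congruence K refl) d∣y = ∣m∣n⇒∣m+n d∣y (m∣m*n K)

mod-∣∸ : ∀ {x y d} → x ≡ y [mod d ] → d ∣ x ∸ y
mod-∣∸ {y = y} {d} (congruence K refl) = divides K (trans (m+n∸m≡n y (d * K)) (*-comm d K))

mod-% : ∀ x d .{{_ : NonZero d}} → x ≡ x % d [mod d ]
mod-% x d = congruence (x / d) (trans (m≡m%n+[m/n]*n x d) (cong (x % d +_) (*-comm (x / d) d)))

%-≡⇒∣∸ : ∀ x y d .{{_ : NonZero d}} → x % d ≡ y % d → d ∣ y ∸ x
%-≡⇒∣∸ x y d eq = divides (y / d ∸ x / d) (begin
  y ∸ x                                      ≡⟨ cong₂ _∸_ (m≡m%n+[m/n]*n y d) (m≡m%n+[m/n]*n x d) ⟩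
  (y % d + y / d * d) ∸ (x % d + x / d * d)  ≡⟨ cong (λ r → (y % d + y / d * d) ∸ (r + x / d * d)) eq ⟩
  (y % d + y / d * d) ∸ (y % d + x / d * d)  ≡⟨ [m+n]∸[m+o]≡n∸o (y % d) _ _ ⟩
  y / d * d ∸ x / d * d                      ≡⟨ *-distribʳ-∸ d (y / d) (x / d) ⟨
  (y / d ∸ x / d) * d                        ∎)

∣-<⇒≡0 : ∀ {d x} → d ∣ x → x < d → x ≡ 0
∣-<⇒≡0 {d} {x} d∣x x<d =
  trans (sym (m<n⇒m%n≡m {{>-nonZero (≤-<-trans z≤n x<d)}} x<d)) (n∣m⇒m%n≡0 x d {{>-nonZero (≤-<-trans z≤n x<d)}} d∣x)

pow-mod : ∀ m {x y d} → x ≡ y [mod d ] → x ^ m ≡ y ^ m [mod d ]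
pow-mod zero    {d = d} _ = congruence 0 (cong suc (sym (*-zeroʳ d)))
pow-mod (suc m) {x} {y} {d} (congruence K refl) with pow-mod m {x} {y} {d} (congruence K refl)
... | congruence W eq = congruence (K * y ^ m + (y + d * K) * W) (begin
  (y + d * K) * (y + d * K) ^ m  ≡⟨ cong ((y + d * K) *_) eq ⟩
  (y + d * K) * (y ^ m + d * W)  ≡⟨ expand y d K (y ^ m) W ⟩
  y * y ^ m + d * (K * y ^ m + (y + d * K) * W) ∎)
  where
  expand : ∀ y d K z W → (y + d * K) * (z + d * W) ≡ y * z + d * (K * z + (y + d * K) * W)
  expand = solve-∀

pow-expand : ∀ x y M → (x + y) ^ suc M ≡ x ^ suc M + y * (suc M * x ^ M) [mod y * y ]
pow-expand x y zero    = congruence 0 (expand x y)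
  where
  expand : ∀ x y → (x + y) * 1 ≡ x * 1 + y * (1 * 1) + y * y * 0
  expand = solve-∀
pow-expand x y (suc M) with pow-expand x y M
... | congruence Q eq = congruence (suc M * x ^ M + (x + y) * Q) (begin
  (x + y) * (x + y) ^ suc M                                ≡⟨ cong ((x + y) *_) eq ⟩
  (x + y) * (x ^ suc M + y * (suc M * x ^ M) + y * y * Q)  ≡⟨ expand x y M Q (x ^ M) ⟩
  x * x ^ suc M + y * (suc (suc M) * (x * x ^ M)) + y * y * (suc M * x ^ M + (x + y) * Q) ∎)
  where
  expand : ∀ x y M Q z → (x + y) * (x * z + y * (suc M * z) + y * y * Q)
           ≡ x * (x * z) + y * (suc (suc M) * (x * z)) + y * y * (suc M * z + (x + y) * Q)
  expand = solve-∀

^-distribʳ-* : ∀ x y m → (x * y) ^ m ≡ x ^ m * y ^ m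
^-distribʳ-* x y zero    = refl
^-distribʳ-* x y (suc m) rewrite ^-distribʳ-* x y m = interchange x y (x ^ m) (y ^ m)
  where
  interchange : ∀ x y a b → x * y * (a * b) ≡ x * a * (y * b)
  interchange = solve-∀

sumBelow : ℕ → (ℕ → ℕ) → ℕ
sumBelow zero    f = 0
sumBelow (suc n) f = f 0 + sumBelow n (λ i → f (suc i))

sumBelow-cong : ∀ n {f g : ℕ → ℕ} → (∀ i → i < n → f i ≡ g i) → sumBelow n f ≡ sumBelow n g
sumBelow-cong zero    eq = refl
sumBelow-cong (suc n) eq = cong₂ _+_ (eq 0 z<s) (sumBelow-cong n (λ i i<n → eq (suc i) (s≤s i<n)))

sumBelow-linear : ∀ n (f g : ℕ → ℕ) c →
                  sumBelow n (λ i → f i + c * g i) ≡ sumBelow n f + c * sumBelow n g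
sumBelow-linear zero    f g c = sym (*-zeroʳ c)
sumBelow-linear (suc n) f g c
  rewrite sumBelow-linear n (λ i → f (suc i)) (λ i → g (suc i)) c = regroup (f 0) (g 0) _ _ c
  where
  regroup : ∀ x y s t c → x + c * y + (s + c * t) ≡ x + s + c * (y + t)
  regroup = solve-∀

sumBelow-* : ∀ n c (f : ℕ → ℕ) → sumBelow n (λ i → c * f i) ≡ c * sumBelow n f
sumBelow-* zero    c f = sym (*-zeroʳ c)
sumBelow-* (suc n) c f rewrite sumBelow-* n c (λ i → f (suc i)) = sym (*-distribˡ-+ c (f 0) _)

sumBelow-const : ∀ n c → sumBelow n (λ _ → c) ≡ n * c
sumBelow-const zero    c = refl
sumBelow-const (suc n) c = cong (c +_) (sumBelow-const n c)

sumBelow-last : ∀ n (f : ℕ → ℕ) → sumBelow (suc n) f ≡ sumBelow n f + f n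
sumBelow-last zero    f = +-comm (f 0) 0
sumBelow-last (suc n) f rewrite sumBelow-last n (λ i → f (suc i)) = sym (+-assoc (f 0) _ _)

sumBelow-mod : ∀ n {f g : ℕ → ℕ} {d} → (∀ i → i < n → f i ≡ g i [mod d ]) →
               sumBelow n f ≡ sumBelow n g [mod d ]
sumBelow-mod zero    {d = d} _ = congruence 0 (sym (*-zeroʳ d))
sumBelow-mod (suc n) {f} {g} {d} congruent
  with congruent 0 z<s | sumBelow-mod n {d = d} (λ i i<n → congruent (suc i) (s≤s i<n))
... | congruence K₀ eq₀ | congruence K eq = congruence (K₀ + K) (trans (cong₂ _+_ eq₀ eq) (regroup (g 0) _ d K₀ K))
  where
  regroup : ∀ x s d K₀ K → x + d * K₀ + (s + d * K) ≡ x + s + d * (K₀ + K)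
  regroup = solve-∀

sumBelow-blocks : ∀ b a (f : ℕ → ℕ) →
                  sumBelow (b * a) f ≡ sumBelow b (λ t → sumBelow a (λ r → f (t * a + r)))
sumBelow-blocks zero    a f = refl
sumBelow-blocks (suc b) a f = begin
  sumBelow (a + b * a) f                             ≡⟨ split a (b * a) f ⟩
  sumBelow a f + sumBelow (b * a) (λ i → f (a + i))  ≡⟨ cong (sumBelow a f +_) (sumBelow-blocks b a _) ⟩
  sumBelow a f + sumBelow b (λ t → sumBelow a (λ r → f (a + (t * a + r))))
    ≡⟨ cong (sumBelow a f +_) (sumBelow-cong b λ t _ → sumBelow-cong a λ r _ → cong f (sym (+-assoc a (t * a) r))) ⟩
  sumBelow a f + sumBelow b (λ t → sumBelow a (λ r → f (suc t * a + r))) ∎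
  where
  split : ∀ a b (f : ℕ → ℕ) → sumBelow (a + b) f ≡ sumBelow a f + sumBelow b (λ i → f (a + i))
  split zero    b f = refl
  split (suc a) b f rewrite split a b (λ i → f (suc i)) = sym (+-assoc (f 0) _ _)

sumBelow-odd : ∀ h → sumBelow (suc (2 * h)) id ≡ h * suc (2 * h)
sumBelow-odd zero    = refl
sumBelow-odd (suc h) = begin
  sumBelow (suc (2 * suc h)) id                 ≡⟨ cong (λ k → sumBelow (suc k) id) (*-suc 2 h) ⟩
  sumBelow (suc (suc (suc (2 * h)))) id
    ≡⟨ trans (sumBelow-last _ id) (cong (_+ suc (suc (2 * h))) (sumBelow-last (suc (2 * h)) id)) ⟩
  sumBelow (suc (2 * h)) id + suc (2 * h) + suc (suc (2 * h))
    ≡⟨ cong (λ s → s + suc (2 * h) + suc (suc (2 * h))) (sumBelow-odd h) ⟩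
  h * suc (2 * h) + suc (2 * h) + suc (suc (2 * h)) ≡⟨ step h ⟩
  suc h * suc (2 * suc h) ∎
  where
  step : ∀ h → h * suc (2 * h) + suc (2 * h) + suc (suc (2 * h)) ≡ suc h * suc (2 * suc h)
  step = solve-∀

open CommutativeMonoidSum +-0-commutativeMonoid using (sum; sum-permute; sum-cong-≗)

-- Agreement with the library's sums over Fin n, which are invariant under permutations.
sumBelow-sum : ∀ n (f : ℕ → ℕ) → sumBelow n f ≡ sum (λ (i : Fin n) → f (toℕ i))
sumBelow-sum zero    f = refl
sumBelow-sum (suc n) f = cong (f 0 +_) (sumBelow-sum n (λ i → f (suc i)))

injective⇒surjective : ∀ {n} (σ : Fin n → Fin n) → Injective _≡_ _≡_ σ → ∀ y → ∃ λ x → σ x ≡ y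
injective⇒surjective {suc n} σ σ-injective y with any? (λ x → σ x Data.Fin.≟ y)
... | yes hit = hit
... | no miss = ⊥-elim (<-irrefl refl (injective⇒≤ squeeze-injective))
  where
  avoids : ∀ x → y ≢ σ x
  avoids x y≡σx = miss (x , sym y≡σx)
  squeeze : Fin (suc n) → Fin n
  squeeze x = punchOut (avoids x)
  squeeze-injective : Injective _≡_ _≡_ squeeze
  squeeze-injective eq = σ-injective (punchOut-injective (avoids _) (avoids _) eq)

sumBelow-reindex : ∀ n (ρ : ℕ → ℕ) (ρ<n : ∀ i → i < n → ρ i < n) →
                   (∀ {i j} → i < n → j < n → ρ i ≡ ρ j → i ≡ j) →
                   ∀ f → sumBelow n (λ i → f (ρ i)) ≡ sumBelow n f
sumBelow-reindex n ρ ρ<n ρ-injective f = begin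
  sumBelow n (λ i → f (ρ i))  ≡⟨ sumBelow-sum n (λ i → f (ρ i)) ⟩
  ∑ (λ i → f (ρ (toℕ i)))     ≡⟨ sum-cong-≗ {n} (λ i → cong f (sym (toℕ-fromℕ< (ρ<n (toℕ i) (toℕ<n i))))) ⟩
  ∑ (λ i → f (toℕ (σ i)))     ≡⟨ sum-permute {n} (λ i → f (toℕ i)) π ⟨
  ∑ (λ i → f (toℕ i))         ≡⟨ sumBelow-sum n f ⟨
  sumBelow n f                ∎
  where
  ∑ : (Fin n → ℕ) → ℕ
  ∑ = sum
  σ : Fin n → Fin n
  σ i = fromℕ< (ρ<n (toℕ i) (toℕ<n i))
  σ-injective : Injective _≡_ _≡_ σ
  σ-injective {i} {j} eq = toℕ-injective (ρ-injective (toℕ<n i) (toℕ<n j)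
    (trans (sym (toℕ-fromℕ< (ρ<n (toℕ i) (toℕ<n i))))
           (trans (cong toℕ eq) (toℕ-fromℕ< (ρ<n (toℕ j) (toℕ<n j))))))
  σ-onto : ∀ y → ∃ λ x → σ x ≡ y
  σ-onto = injective⇒surjective σ σ-injective
  π : Permutation n n
  π = mk↔ₛ′ σ (proj₁ ∘ σ-onto) (proj₂ ∘ σ-onto) (λ x → σ-injective (proj₂ (σ-onto (σ x))))

S : ℕ → ℕ → ℕ
S e n = sumBelow n (λ j → j ^ e)

-- (blocks)  Each of the b blocks of length d contributes S e d modulo d.
S-blocks : ∀ e b d → S e (b * d) ≡ b * S e d [mod d ]
S-blocks e b d =
  subst₂ (λ u v → u ≡ v [mod d ]) (sym (sumBelow-blocks b d (λ j → j ^ e))) (sumBelow-const b (S e d))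
    (sumBelow-mod b λ t _ → sumBelow-mod d λ r _ → pow-mod e (shift t r))
  where
  shift : ∀ t r → t * d + r ≡ r [mod d ]
  shift t r = congruence t (trans (+-comm (t * d) r) (cong (r +_) (*-comm t d)))

S-shift : ∀ M a y → sumBelow a (λ r → (r + y) ^ suc M)
                    ≡ S (suc M) a + y * sumBelow a (λ r → suc M * r ^ M) [mod y * y ]
S-shift M a y =
  subst (λ v → sumBelow a (λ r → (r + y) ^ suc M) ≡ v [mod y * y ]) (sumBelow-linear a _ _ y)
    (sumBelow-mod a λ r _ → pow-expand r y M)

-- (lift)  For odd b ∣ a, expand each block of length a to first order: the linear terms
-- sum to a multiple of a·Σ_{t<b} t = a·b·(b−1)/2 and the quadratic ones to a multiple of
-- a², both divisible by b·a.
S-lift : ∀ h M {a} → suc (2 * h) ∣ a →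
         S (suc M) (suc (2 * h) * a) ≡ suc (2 * h) * S (suc M) a [mod suc (2 * h) * a ]
S-lift h M (divides a′ refl) = congruence (h * C + a′ * E) (begin
  S (suc M) (b * a)                                             ≡⟨ sumBelow-blocks b a _ ⟩
  sumBelow b (λ t → sumBelow a (λ r → (t * a + r) ^ suc M))
    ≡⟨ sumBelow-cong b (λ t _ → sumBelow-cong a λ r _ → cong (_^ suc M) (+-comm (t * a) r)) ⟩
  sumBelow b (λ t → sumBelow a (λ r → (r + t * a) ^ suc M))
    ≡⟨ sumBelow-cong b (λ t _ → trans (mod-equation (S-shift M a (t * a))) (regroup (S (suc M) a) t a C (D t))) ⟩
  sumBelow b (λ t → S (suc M) a + a * C * t + a * a * (t * t * D t))
    ≡⟨ sumBelow-linear b (λ t → S (suc M) a + a * C * t) (λ t → t * t * D t) (a * a) ⟩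
  sumBelow b (λ t → S (suc M) a + a * C * t) + a * a * E
    ≡⟨ cong (_+ a * a * E) (sumBelow-linear b (λ _ → S (suc M) a) id (a * C)) ⟩
  sumBelow b (λ _ → S (suc M) a) + a * C * sumBelow b id + a * a * E
    ≡⟨ cong₂ (λ s u → s + a * C * u + a * a * E) (sumBelow-const b (S (suc M) a)) (sumBelow-odd h) ⟩
  b * S (suc M) a + a * C * (h * b) + a * a * E ≡⟨ factor b a′ (S (suc M) a) C h E ⟩
  b * S (suc M) a + b * a * (h * C + a′ * E) ∎)
  where
  b a C E : ℕ
  b = suc (2 * h)
  a = a′ * b
  C = sumBelow a (λ r → suc M * r ^ M)
  D : ℕ → ℕ
  D t = mod-quotient (S-shift M a (t * a))
  E = sumBelow b (λ t → t * t * D t)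
  regroup : ∀ X t a C Dt → X + t * a * C + t * a * (t * a) * Dt ≡ X + a * C * t + a * a * (t * t * Dt)
  regroup = solve-∀
  factor : ∀ b a′ X C h E → b * X + a′ * b * C * (h * b) + a′ * b * (a′ * b) * E
                            ≡ b * X + b * (a′ * b) * (h * C + a′ * E)
  factor = solve-∀

coprime-∣-* : ∀ {b a X} → Coprime b a → b ∣ X → a ∣ X → b * a ∣ X
coprime-∣-* {b} {a} coprime (divides q refl) a∣X =
  subst (b * a ∣_) (*-comm b q)
    (*-monoʳ-∣ b (coprime-divisor (Coprime.sym coprime) (subst (a ∣_) (*-comm q b) a∣X)))

S-coprime-split : ∀ {e b a} → Coprime b a → b * a ∣ S e (b * a) → b ∣ S e b × a ∣ S e a
S-coprime-split {e} {b} {a} coprime ba∣S =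
    coprime-divisor coprime (mod-∣⇒ (S-blocks e a b) (subst (λ n → b ∣ S e n) (*-comm b a) (m*n∣⇒m∣ b a ba∣S)))
  , coprime-divisor (Coprime.sym coprime) (mod-∣⇒ (S-blocks e b a) (m*n∣⇒n∣ b a ba∣S))

S-coprime-join : ∀ {e b a} → Coprime b a → b ∣ S e b → a ∣ S e a → b * a ∣ S e (b * a)
S-coprime-join {e} {b} {a} coprime b∣S a∣S = coprime-∣-* coprime
  (subst (λ n → b ∣ S e n) (*-comm a b) (mod-∣⇐ (S-blocks e a b) (∣n⇒∣m*n a b∣S)))
  (mod-∣⇐ (S-blocks e b a) (∣n⇒∣m*n b a∣S))

S-lift-⇒ : ∀ h M {a} → suc (2 * h) ∣ a → suc (2 * h) * a ∣ S (suc M) (suc (2 * h) * a) → a ∣ S (suc M) a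
S-lift-⇒ h M b∣a ba∣S = *-cancelˡ-∣ (suc (2 * h)) (mod-∣⇒ (S-lift h M b∣a) ba∣S)

S-lift-⇐ : ∀ h M {a} → suc (2 * h) ∣ a → a ∣ S (suc M) a → suc (2 * h) * a ∣ S (suc M) (suc (2 * h) * a)
S-lift-⇐ h M b∣a a∣S = mod-∣⇐ (S-lift h M b∣a) (*-monoʳ-∣ (suc (2 * h)) a∣S)

S-pow-reduce : ∀ h M k → let n = suc (2 * h) in n ^ suc k ∣ S (suc M) (n ^ suc k) → n ∣ S (suc M) n
S-pow-reduce h M zero    n∣S = subst (λ n → n ∣ S (suc M) n) (*-identityʳ (suc (2 * h))) n∣S
S-pow-reduce h M (suc k) nⁿ∣S = S-pow-reduce h M k (S-lift-⇒ h M (m∣m*n _) nⁿ∣S)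

module PrimeModulus {P : ℕ} (P-prime : Prime P) where

  private instance
    P-nonZero : NonZero P
    P-nonZero = prime⇒nonZero P-prime

  private
    -- For x ≤ y write y = x + d: then P ∣ g·d, while P divides neither g nor a nonzero d < P.
    *-%-injective-ordered : ∀ {g x y} → 0 < g → g < P → y < P → x ≤ y →
                            (g * x) % P ≡ (g * y) % P → x ≡ y
    *-%-injective-ordered {g} {x} 0<g g<P y<P x≤y eq with m≤n⇒∃[o]m+o≡n x≤y
    ... | d , refl with euclidsLemma g d P-prime P∣gd
      where
      P∣gd : P ∣ g * d
      P∣gd = subst (P ∣_) (trans (cong (_∸ g * x) (*-distribˡ-+ g x d)) (m+n∸m≡n (g * x) (g * d)))
                          (%-≡⇒∣∸ (g * x) (g * (x + d)) P eq)
    ... | inj₁ P∣g = ⊥-elim (<-irrefl (sym (∣-<⇒≡0 P∣g g<P)) 0<g)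
    ... | inj₂ P∣d = trans (sym (+-identityʳ x)) (cong (x +_) (sym (∣-<⇒≡0 P∣d (≤-<-trans (m≤n+m d x) y<P))))

  *-%-injective : ∀ {g x y} → 0 < g → g < P → x < P → y < P → (g * x) % P ≡ (g * y) % P → x ≡ y
  *-%-injective {x = x} {y} 0<g g<P x<P y<P eq with ≤-total x y
  ... | inj₁ x≤y = *-%-injective-ordered 0<g g<P y<P x≤y eq
  ... | inj₂ y≤x = sym (*-%-injective-ordered 0<g g<P x<P y≤x (sym eq))

  -- Since j ↦ g·j mod P permutes [0,P), scaling by g^m leaves S m P unchanged modulo P.
  S-scaled : ∀ {g} m → 0 < g → g < P → g ^ m * S m P ≡ S m P [mod P ]
  S-scaled {g} m 0<g g<P = subst₂ (λ u v → u ≡ v [mod P ]) scale permute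
    (sumBelow-mod P λ j _ → pow-mod m (mod-% (g * j) P))
    where
    scale : sumBelow P (λ j → (g * j) ^ m) ≡ g ^ m * S m P
    scale = trans (sumBelow-cong P λ j _ → ^-distribʳ-* g j m) (sumBelow-* P (g ^ m) (_^ m))
    permute : sumBelow P (λ j → ((g * j) % P) ^ m) ≡ S m P
    permute = sumBelow-reindex P (λ j → (g * j) % P) (λ j _ → m%n<n (g * j) P)
                (*-%-injective 0<g g<P) (_^ m)

  -- Hence if g^m ≢ 1 (mod P) for a unit g, then P ∣ (g^m − 1)·S m P forces P ∣ S m P.
  nonResidue⇒∣S : ∀ {g m} → 0 < g → g < P → g ^ m % P ≢ 1 → P ∣ S m P
  nonResidue⇒∣S {g} {m} 0<g g<P g^m≢1 with euclidsLemma (g ^ m ∸ 1) (S m P) P-prime P∣[g^m∸1]S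
    where
    P∣[g^m∸1]S : P ∣ (g ^ m ∸ 1) * S m P
    P∣[g^m∸1]S = subst (P ∣_) (trans (cong (g ^ m * S m P ∸_) (sym (*-identityˡ (S m P))))
                                     (sym (*-distribʳ-∸ (S m P) (g ^ m) 1)))
                              (mod-∣∸ (S-scaled m 0<g g<P))
  ... | inj₂ P∣S    = P∣S
  ... | inj₁ P∣g^m∸1 = ⊥-elim (g^m≢1 (begin
    g ^ m % P            ≡⟨ cong (_% P) (sym (m+[n∸m]≡n (m^n>0 g {{>-nonZero 0<g}} m))) ⟩
    (1 + (g ^ m ∸ 1)) % P ≡⟨ %-remove-+ʳ 1 P∣g^m∸1 ⟩
    1 % P                ≡⟨ m<n⇒m%n≡m (nonTrivial⇒n>1 P {{prime⇒nonTrivial P-prime}}) ⟩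
    1                    ∎))

-- If (1+i)^m ≡ 1 (mod p+1) for every i < p and m ∣ M, then S M (p+1) ≡ p (mod p+1),
-- which p+1 does not divide when p > 0.
allResidues⇒∤S : ∀ {p} m {M} → 0 < p → (∀ i → i < p → suc i ^ m % suc p ≡ 1) → m ∣ suc M →
                  ¬ suc p ∣ S (suc M) (suc p)
allResidues⇒∤S {p} m {M} 0<p residues (divides q M≡qm) P∣S = <-irrefl (sym p≡0) 0<p
  where
  term : ∀ i → i < p → suc i ^ suc M ≡ 1 [mod suc p ]
  term i i<p = subst₂ (λ u v → u ≡ v [mod suc p ])
    (trans (^-*-assoc (suc i) m q) (cong (suc i ^_) (trans (*-comm m q) (sym M≡qm)))) (^-zeroˡ q)
    (pow-mod q (subst (λ v → suc i ^ m ≡ v [mod suc p ]) (residues i i<p) (mod-% (suc i ^ m) (suc p))))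
  S≡p : S (suc M) (suc p) ≡ p * 1 [mod suc p ]
  S≡p = subst (λ v → S (suc M) (suc p) ≡ v [mod suc p ]) (sumBelow-const p 1) (sumBelow-mod p term)
  p≡0 : p ≡ 0
  p≡0 = trans (sym (*-identityʳ p)) (∣-<⇒≡0 (mod-∣⇒ S≡p P∣S) (s≤s (≤-reflexive (*-identityʳ p))))

S-prime-transfer : ∀ {P m M} → Prime P → suc m ∣ suc M → P ∣ S (suc M) P → P ∣ S (suc m) P
S-prime-transfer {suc p} {m} P-prime m∣M P∣S
  with anyUpTo? (λ i → ¬? (suc i ^ suc m % suc p ≟ 1)) p
... | yes (i , i<p , nonResidue) = PrimeModulus.nonResidue⇒∣S P-prime {m = suc m} z<s (s≤s i<p) nonResidue
... | no noNonResidue = ⊥-elim (allResidues⇒∤S (suc m) 0<p residues m∣M P∣S)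
  where
  0<p : 0 < p
  0<p = ≤-pred (nonTrivial⇒n>1 (suc p) {{prime⇒nonTrivial P-prime}})
  residues : ∀ i → i < p → suc i ^ suc m % suc p ≡ 1
  residues i i<p = decidable-stable (suc i ^ suc m % suc p ≟ 1) (λ ne → noNonResidue (i , i<p , ne))

primeDivisor : ∀ n → 2 ≤ n → ∃ λ p → Prime p × p ∣ n
primeDivisor (suc (suc k)) (s≤s (s≤s _)) with factorise (suc (suc k))
... | record { factors = p ∷ ps ; isFactorisation = n≡p*ps ; factorsPrime = p-prime ∷ _ } =
  p , p-prime , divides (product ps) (trans n≡p*ps (*-comm p (product ps)))

prime∤⇒coprime : ∀ {p r} → Prime p → ¬ p ∣ r → Coprime p r
prime∤⇒coprime p-prime p∤r (i∣p , i∣r) with prime⇒irreducible p-prime i∣p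
... | inj₁ i≡1 = i≡1
... | inj₂ refl = ⊥-elim (p∤r i∣r)

odd⇒2h+1 : ∀ {n} → ¬ 2 ∣ n → ∃ λ h → n ≡ suc (2 * h)
odd⇒2h+1 {zero}        n-odd = ⊥-elim (n-odd (2 ∣0))
odd⇒2h+1 {suc zero}    _     = 0 , refl
odd⇒2h+1 {suc (suc n)} n-odd with odd⇒2h+1 {n} (λ 2∣n → n-odd (∣m∣n⇒∣m+n (∣-refl {2}) 2∣n))
... | h , refl = suc h , cong (suc ∘ suc) (sym (+-suc h (h + 0)))

-- The inductive step of the transfer: n = p·r with p an odd prime, assuming the transfer for r.
-- If p ∣ r we use (lift), otherwise (blocks) with coprimality together with (prime).
S-transfer-step : ∀ {p r m M} → Prime p → ¬ 2 ∣ p → suc m ∣ suc M →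
                  (r ∣ S (suc M) r → r ∣ S (suc m) r) →
                  p * r ∣ S (suc M) (p * r) → p * r ∣ S (suc m) (p * r)
S-transfer-step {p} {r} {m} {M} p-prime p-odd m∣M transfer-r pr∣S with p ∣? r | odd⇒2h+1 p-odd
... | yes p∣r | h , refl = S-lift-⇐ h m p∣r (transfer-r (S-lift-⇒ h M p∣r pr∣S))
... | no p∤r  | _        = S-coprime-join {suc m} coprime
  (S-prime-transfer p-prime m∣M (proj₁ (S-coprime-split {suc M} coprime pr∣S)))
  (transfer-r (proj₂ (S-coprime-split {suc M} coprime pr∣S)))
  where
  coprime : Coprime p r
  coprime = prime∤⇒coprime p-prime p∤r

S-transfer : ∀ {m M} → suc m ∣ suc M → ∀ n → ¬ 2 ∣ n → n ∣ S (suc M) n → n ∣ S (suc m) n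
S-transfer {m} {M} m∣M = <-rec Transfer step
  where
  Transfer : ℕ → Set
  Transfer n = ¬ 2 ∣ n → n ∣ S (suc M) n → n ∣ S (suc m) n
  step : ∀ n → (∀ {r} → r < n → Transfer r) → Transfer n
  step zero          _        n-odd _   = ⊥-elim (n-odd (2 ∣0))
  step (suc zero)    _        _     _   = 1∣ _
  step n@(suc (suc _)) transfer n-odd n∣S with primeDivisor n (s≤s (s≤s z≤n))
  ... | p , p-prime , p∣n@(divides r n≡r*p) =
    subst (λ k → k ∣ S (suc m) k) (sym n≡p*r)
      (S-transfer-step p-prime (λ 2∣p → n-odd (∣-trans 2∣p p∣n)) m∣M
        (transfer (quotient-< p∣n {{prime⇒nonTrivial p-prime}}) (λ 2∣r → n-odd (∣-trans 2∣r (quotient-∣ p∣n))))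
        (subst (λ k → k ∣ S (suc M) k) n≡p*r n∣S))
    where
    n≡p*r : n ≡ p * r
    n≡p*r = trans n≡r*p (*-comm r p)

sumFrom1-sumBelow : ∀ n (f : ℕ → ℕ) → f 0 ≡ 0 → sumFrom1 n f ≡ sumBelow (suc n) f
sumFrom1-sumBelow zero    f f0≡0 = sym (trans (+-identityʳ (f 0)) f0≡0)
sumFrom1-sumBelow (suc n) f f0≡0 =
  trans (cong (_+ f (suc n)) (sumFrom1-sumBelow n f f0≡0)) (sym (sumBelow-last (suc n) f))

-- For N = 2M+1 with M ≥ 1, G(N) is the power sum S M N (the j = 0 term vanishes).
G≡S : ∀ M → G (suc (2 * suc M)) ≡ S (suc M) (suc (2 * suc M))
G≡S M = trans (cong (λ e → sumFrom1 (2 * suc M) (λ j → j ^ e)) half)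
              (sumFrom1-sumBelow (2 * suc M) (λ j → j ^ suc M) refl)
  where
  half : 2 * suc M / 2 ≡ suc M
  half = trans (cong (_/ 2) (*-comm 2 (suc M))) (m*n/n≡m (suc M) 2)

Odd⇒¬2∣ : ∀ {n} → Odd n → ¬ 2 ∣ n
Odd⇒¬2∣ {n} n%2≡1 2∣n with trans (sym n%2≡1) (n∣m⇒m%n≡0 n 2 2∣n)
... | ()

2h+1-Odd : ∀ h → Odd (suc (2 * h))
2h+1-Odd h = trans (cong (λ k → suc k % 2) (*-comm 2 h)) ([m+kn]%n≡m%n 1 h 2)

pow-suc-form : ∀ x c → ∃ λ T → suc x ^ suc c ≡ suc (x * suc T)
pow-suc-form x zero    = 0 , refl
pow-suc-form x (suc c) with pow-suc-form x c
... | T , eq = T + suc (x * suc T) , trans (cong (suc x *_) eq) (expand x T)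
  where
  expand : ∀ x T → suc x * suc (x * suc T) ≡ suc (x * suc (T + suc (x * suc T)))
  expand = solve-∀

-- The base of an odd power is odd; n = 1 is trivial.  For n = 2(h+1)+1 write n^k = 2(M+1)+1;
-- then n^k ∣ S (M+1) (n^k) lifts down to n ∣ S (M+1) n, which transfers to n ∣ S (h+1) n = G(n).
mainTheorem7 : (n k : ℕ) → n ≥ 1 → k ≥ 1 → InP (n ^ k) → InP n
mainTheorem7 n (suc c) _ _ (nᵏ-odd , nᵏ∣G) with odd⇒2h+1 {n} (λ 2∣n → Odd⇒¬2∣ nᵏ-odd (∣m⇒∣m*n (n ^ c) 2∣n))
... | zero  , refl = refl , 1∣ _
... | suc h , refl = 2h+1-Odd (suc h) ,
  subst (n ∣_) (sym (G≡S h)) (S-transfer h+1∣M+1 n (Odd⇒¬2∣ (2h+1-Odd (suc h))) (S-pow-reduce (suc h) M c nᵏ∣S))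
  where
  -- n^k = 2(M+1) + 1 with M + 1 = (h+1)(T+1), so (n−1)/2 = h+1 divides M + 1.
  T M : ℕ
  T = proj₁ (pow-suc-form (2 * suc h) c)
  M = T + h * suc T
  h+1∣M+1 : suc h ∣ suc M
  h+1∣M+1 = divides (suc T) (*-comm (suc h) (suc T))
  nᵏ≡2M+1 : n ^ suc c ≡ suc (2 * suc M)
  nᵏ≡2M+1 = trans (proj₂ (pow-suc-form (2 * suc h) c)) (cong suc (*-assoc 2 (suc h) (suc T)))
  nᵏ∣S : n ^ suc c ∣ S (suc M) (n ^ suc c)
  nᵏ∣S = subst (λ N → N ∣ S (suc M) N) (sym nᵏ≡2M+1)
           (subst (suc (2 * suc M) ∣_) (G≡S M) (subst (λ N → N ∣ G N) nᵏ≡2M+1 nᵏ∣G))
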